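{- Let $C_n(q)\in\mathbb{Z}[q]$ be defined by $C_0(q)=1$ and $C_{n+1}(q)=\sum_{k=0}^nq^kC_k(q)C_{n-k}(q)$, and let $C^*_n(q)=C_{n/2}(q)$ if $n$ is even and $C^*_n(q)=0$ if $n$ is odd. Then for every $n\geq0$ the matrix $(C^*_{i+j}(q))_{0\leq i,j\leq n}$ has special Smith normal form $\mathrm{diag}(1,q^{\binom12},q^{\binom22},\ldots,q^{\binom n2})$ over $\mathbb{Z}[q]$.
   Context: For an $m\times n$ matrix $A$ over a commutative ring $R$, a matrix $D$ is a special Smith normal form (SSNF) of $A$ over $R$ if there exist $P\in \mathrm{SL}(m,R)$, $Q\in\mathrm{SL}(n,R)$ with $PAQ=D$, $D$ is diagonal, and $d_{ii}$ is a multiple in $R$ of $d_{jj}$ whenever $i\geq j$. -}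

module Defs where

open import Data.Nat using (ℕ; zero; suc; _∸_; _≤_; _%_; _/_)
open import Data.Nat.Combinatorics using (_C_)
open import Data.Integer using (ℤ; 0ℤ; 1ℤ; -1ℤ) renaming (_+_ to _+ℤ_; _*_ to _*ℤ_)
open import Data.List using (List; []; _∷_; _++_; replicate; map; foldr; upTo)
open import Data.Fin using (Fin; zero; suc; toℕ; punchIn)
open import Data.Fin.Properties using (_≟_)
open import Data.Product using (Σ; _×_; ∃)
open import Relation.Binary.PropositionalEquality using (_≡_; _≢_)
open import Relation.Nullary using (yes; no)

-- The polynomial ring ℤ[q]: coefficient lists (constant term first),
-- compared up to trailing zeros (coefficientwise equality).

Poly : Set
Poly = List ℤ

coeff : Poly → ℕ → ℤ
coeff []      _       = 0ℤ
coeff (a ∷ p) zero    = a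
coeff (a ∷ p) (suc i) = coeff p i

infix 4 _≈ₚ_
_≈ₚ_ : Poly → Poly → Set
p ≈ₚ r = ∀ i → coeff p i ≡ coeff r i

zeroₚ oneₚ : Poly
zeroₚ = []
oneₚ  = 1ℤ ∷ []

infixl 6 _+ₚ_
_+ₚ_ : Poly → Poly → Poly
[]      +ₚ r       = r
(a ∷ p) +ₚ []      = a ∷ p
(a ∷ p) +ₚ (b ∷ r) = (a +ℤ b) ∷ (p +ₚ r)

scaleₚ : ℤ → Poly → Poly
scaleₚ a = map (a *ℤ_)

infixl 7 _*ₚ_
_*ₚ_ : Poly → Poly → Poly
[]      *ₚ r = []
(a ∷ p) *ₚ r = scaleₚ a r +ₚ (0ℤ ∷ (p *ₚ r))

qpow : ℕ → Poly
qpow k = replicate k 0ℤ ++ (1ℤ ∷ [])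

infix 4 _∣ₚ_
_∣ₚ_ : Poly → Poly → Set
a ∣ₚ b = Σ Poly (λ c → c *ₚ a ≈ₚ b)

nth : ℕ → List Poly → Poly
nth _       []      = zeroₚ
nth zero    (x ∷ _) = x
nth (suc i) (_ ∷ l) = nth i l

-- catList n = [C_0, C_1, ..., C_n]
catList : ℕ → List Poly
catList zero    = oneₚ ∷ []
catList (suc n) = L ++ (next ∷ [])
  where
  L = catList n
  next = foldr _+ₚ_ zeroₚ
           (map (λ k → qpow k *ₚ nth k L *ₚ nth (n ∸ k) L) (upTo (suc n)))

Cq : ℕ → Poly
Cq n = nth n (catList n)

Cstar : ℕ → Poly
Cstar n with n % 2
... | zero  = Cq (n / 2)
... | suc _ = zeroₚ

Matrix : ℕ → ℕ → Set
Matrix m n = Fin m → Fin n → Poly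

sumF : ∀ {n} → (Fin n → Poly) → Poly
sumF {zero}  f = zeroₚ
sumF {suc n} f = f zero +ₚ sumF (λ i → f (suc i))

infixl 7 _·_
_·_ : ∀ {m k n} → Matrix m k → Matrix k n → Matrix m n
(A · B) i j = sumF (λ l → A i l *ₚ B l j)

signₚ : ℕ → Poly
signₚ zero          = oneₚ
signₚ (suc zero)    = -1ℤ ∷ []
signₚ (suc (suc k)) = signₚ k

det : ∀ {n} → Matrix n n → Poly
det {zero}  A = oneₚ
det {suc n} A = sumF (λ i → signₚ (toℕ i) *ₚ A i zero *ₚ
                              det (λ r c → A (punchIn i r) (suc c)))

IsSL : ∀ {n} → Matrix n n → Set
IsSL P = det P ≈ₚ oneₚ

IsDiagonal : ∀ {m n} → Matrix m n → Set
IsDiagonal {m} {n} D = ∀ (i : Fin m) (j : Fin n) → toℕ i ≢ toℕ j → D i j ≈ₚ zeroₚ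

IsSSNF : ∀ {m n} → Matrix m n → Matrix m n → Set
IsSSNF {m} {n} A D =
  Σ (Matrix m m) (λ P → Σ (Matrix n n) (λ Q →
    IsSL P × IsSL Q × (∀ i j → (P · A · Q) i j ≈ₚ D i j))) ×
  IsDiagonal D ×
  (∀ (i j : Fin m) (i' j' : Fin n) → toℕ i ≡ toℕ i' → toℕ j ≡ toℕ j' →
     toℕ j ≤ toℕ i → D j j' ∣ₚ D i i')

hankelCstar : (n : ℕ) → Matrix (suc n) (suc n)
hankelCstar n i j = Cstar (toℕ i Data.Nat.+ toℕ j)

diagBinom : (n : ℕ) → Matrix (suc n) (suc n)
diagBinom n i j with i ≟ j
... | yes _ = qpow (toℕ i C 2)
... | no  _ = zeroₚ

module Submission where

-- The proof is the continued-fraction (Stieltjes–Viennot) argument.  Weight a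
-- Dyck step that goes down to height h by q^h, and let T(n,k) be the total
-- weight of the lattice paths of length n from height 0 to height k.  Then
--   (1) T(n,0) = C*_n: odd lengths give 0, and the first-return decomposition
--       of a path turns the recursion of T into the one of C_n;
--   (2) H = T · diag(D_k) · Tᵀ with D_k = q^(k choose 2), the product of the
--       down-step weights from height k to 0 (cut a path of length i+j after
--       i steps);
--   (3) T is lower unitriangular with explicit inverse P, the coefficient
--       matrix of the orthogonal polynomials p_{n+2} = x p_{n+1} - q^n p_n.
-- Hence P · H · Pᵀ = diag(D_k), P and Pᵀ are unitriangular (determinant 1),
-- and D_j ∣ D_i for j ≤ i, which is the theorem.

open import Defs
open import Algebra.Bundles using (CommutativeRing)
open import Data.Nat as ℕ using (ℕ; zero; suc; _∸_; _≤_; _<_; s≤s; z≤n; _%_; _/_)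
import Data.Nat.Properties as ℕP
open import Data.Integer using (0ℤ; 1ℤ)
open import Data.Nat.DivMod using (m≡m%n+[m/n]*n; m%n<n)
open import Data.Nat.Combinatorics using (_C_; nC1≡n; nCk+nC[k+1]≡[n+1]C[k+1])
open import Data.List using (List; []; _∷_; _++_; length; map; foldr; applyUpTo)
open import Data.List.Properties using (length-++)
open import Data.Fin using (Fin; zero; suc; toℕ; punchIn)
open import Data.Fin.Properties using (_≟_; toℕ-injective; toℕ<n)
open import Data.Product using (_,_)
open import Data.Sum using (inj₁; inj₂)
open import Data.Empty using (⊥-elim)
open import Relation.Nullary using (¬_; yes; no)
open import Relation.Binary.PropositionalEquality as Eq using (_≡_; cong)

module PolyRing where

  open Eq using (refl; sym; trans; cong₂)
  open import Data.Integer using (-_) renaming (_+_ to _+ℤ_; _*_ to _*ℤ_)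
  import Data.Integer.Properties as ℤP
  open import Data.Integer.Tactic.RingSolver using (solve-∀)

  tail : Poly → Poly
  tail []      = []
  tail (_ ∷ p) = p

  coeff-tail : ∀ p i → coeff (tail p) i ≡ coeff p (suc i)
  coeff-tail []      i = refl
  coeff-tail (x ∷ p) i = refl

  coeff-+ : ∀ p r i → coeff (p +ₚ r) i ≡ coeff p i +ℤ coeff r i
  coeff-+ []      r       i       = sym (ℤP.+-identityˡ (coeff r i))
  coeff-+ (a ∷ p) []      i       = sym (ℤP.+-identityʳ (coeff (a ∷ p) i))
  coeff-+ (a ∷ p) (b ∷ r) zero    = refl
  coeff-+ (a ∷ p) (b ∷ r) (suc i) = coeff-+ p r i

  coeff-scale : ∀ a p i → coeff (scaleₚ a p) i ≡ a *ℤ coeff p i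
  coeff-scale a []      i       = sym (ℤP.*-zeroʳ a)
  coeff-scale a (b ∷ p) zero    = refl
  coeff-scale a (b ∷ p) (suc i) = coeff-scale a p i

  coeff-*-zero : ∀ p r → coeff (p *ₚ r) 0 ≡ coeff p 0 *ℤ coeff r 0
  coeff-*-zero []      r = refl
  coeff-*-zero (a ∷ p) r = trans (coeff-+ (scaleₚ a r) (0ℤ ∷ (p *ₚ r)) 0)
    (trans (ℤP.+-identityʳ _) (coeff-scale a r 0))

  coeff-*-suc : ∀ p r i →
    coeff (p *ₚ r) (suc i) ≡ coeff p 0 *ℤ coeff r (suc i) +ℤ coeff (tail p *ₚ r) i
  coeff-*-suc []      r i = refl
  coeff-*-suc (a ∷ p) r i = trans (coeff-+ (scaleₚ a r) (0ℤ ∷ (p *ₚ r)) (suc i))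
    (cong (_+ℤ coeff (p *ₚ r) i) (coeff-scale a r (suc i)))

  -- Coefficientwise equality, wrapped in a record so that its two sides can
  -- be inferred by unification.
  infix 4 _≋_
  record _≋_ (p r : Poly) : Set where
    constructor ⟨_⟩
    field un : p ≈ₚ r
  open _≋_ public

  ≋-refl : ∀ {p} → p ≋ p
  ≋-refl = ⟨ (λ i → refl) ⟩

  ≋-sym : ∀ {p r} → p ≋ r → r ≋ p
  ≋-sym e = ⟨ (λ i → sym (un e i)) ⟩

  ≋-trans : ∀ {p r s} → p ≋ r → r ≋ s → p ≋ s
  ≋-trans e f = ⟨ (λ i → trans (un e i) (un f i)) ⟩

  ≡⇒≋ : ∀ {p r} → p ≡ r → p ≋ r
  ≡⇒≋ refl = ≋-refl

  ∷-cong : ∀ {a b p r} → a ≡ b → p ≋ r → (a ∷ p) ≋ (b ∷ r)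
  ∷-cong {a} {b} {p} {r} e f = ⟨ coeffs ⟩
    where
    coeffs : (a ∷ p) ≈ₚ (b ∷ r)
    coeffs zero    = e
    coeffs (suc i) = un f i

  -- The zero polynomial may carry trailing zero coefficients.
  zero∷ : ∀ {p} → p ≋ [] → (0ℤ ∷ p) ≋ []
  zero∷ {p} e = ⟨ coeffs ⟩
    where
    coeffs : (0ℤ ∷ p) ≈ₚ []
    coeffs zero    = refl
    coeffs (suc i) = un e i

  tail-cong : ∀ {p r} → p ≋ r → tail p ≋ tail r
  tail-cong {p} {r} e =
    ⟨ (λ i → trans (coeff-tail p i) (trans (un e (suc i)) (sym (coeff-tail r i)))) ⟩

  +-cong : ∀ {p p' r r'} → p ≋ p' → r ≋ r' → (p +ₚ r) ≋ (p' +ₚ r')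
  +-cong {p} {p'} {r} {r'} e f = ⟨ (λ i →
    trans (coeff-+ p r i) (trans (cong₂ _+ℤ_ (un e i) (un f i)) (sym (coeff-+ p' r' i)))) ⟩

  +-comm : ∀ p r → (p +ₚ r) ≋ (r +ₚ p)
  +-comm p r = ⟨ (λ i → trans (coeff-+ p r i)
    (trans (ℤP.+-comm (coeff p i) (coeff r i)) (sym (coeff-+ r p i)))) ⟩

  +-assoc : ∀ p r s → ((p +ₚ r) +ₚ s) ≋ (p +ₚ (r +ₚ s))
  +-assoc p r s = ⟨ (λ i → begin
    coeff ((p +ₚ r) +ₚ s) i              ≡⟨ coeff-+ (p +ₚ r) s i ⟩
    coeff (p +ₚ r) i +ℤ coeff s i        ≡⟨ cong (_+ℤ coeff s i) (coeff-+ p r i) ⟩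
    (coeff p i +ℤ coeff r i) +ℤ coeff s i ≡⟨ ℤP.+-assoc (coeff p i) (coeff r i) (coeff s i) ⟩
    coeff p i +ℤ (coeff r i +ℤ coeff s i) ≡⟨ cong (coeff p i +ℤ_) (coeff-+ r s i) ⟨
    coeff p i +ℤ coeff (r +ₚ s) i        ≡⟨ coeff-+ p (r +ₚ s) i ⟨
    coeff (p +ₚ (r +ₚ s)) i              ∎) ⟩
    where open Eq.≡-Reasoning

  +-interchange : ∀ x y z w → ((x +ₚ y) +ₚ (z +ₚ w)) ≋ ((x +ₚ z) +ₚ (y +ₚ w))
  +-interchange x y z w = ⟨ (λ i → trans (coeff-+ (x +ₚ y) _ i)
    (trans (cong₂ _+ℤ_ (coeff-+ x y i) (coeff-+ z w i))
    (trans (interchange (coeff x i) (coeff y i) (coeff z i) (coeff w i))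
    (sym (trans (coeff-+ (x +ₚ z) _ i) (cong₂ _+ℤ_ (coeff-+ x z i) (coeff-+ y w i))))))) ⟩
    where
    interchange : ∀ a b c d → (a +ℤ b) +ℤ (c +ℤ d) ≡ (a +ℤ c) +ℤ (b +ℤ d)
    interchange = solve-∀

  +-identityʳ : ∀ p → (p +ₚ []) ≋ p
  +-identityʳ p = ⟨ (λ i → trans (coeff-+ p [] i) (ℤP.+-identityʳ _)) ⟩

  negₚ : Poly → Poly
  negₚ = map (-_)

  coeff-neg : ∀ p i → coeff (negₚ p) i ≡ - coeff p i
  coeff-neg []      i       = refl
  coeff-neg (a ∷ p) zero    = refl
  coeff-neg (a ∷ p) (suc i) = coeff-neg p i

  neg-cong : ∀ {p r} → p ≋ r → negₚ p ≋ negₚ r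
  neg-cong {p} {r} e = ⟨ (λ i →
    trans (coeff-neg p i) (trans (cong -_ (un e i)) (sym (coeff-neg r i)))) ⟩

  +-inverseˡ : ∀ p → (negₚ p +ₚ p) ≋ []
  +-inverseˡ p = ⟨ (λ i → trans (coeff-+ (negₚ p) p i)
    (trans (cong (_+ℤ coeff p i) (coeff-neg p i)) (ℤP.+-inverseˡ (coeff p i)))) ⟩

  +-inverseʳ : ∀ p → (p +ₚ negₚ p) ≋ []
  +-inverseʳ p = ≋-trans (+-comm p (negₚ p)) (+-inverseˡ p)

  scale-+ : ∀ a p r → scaleₚ a (p +ₚ r) ≋ (scaleₚ a p +ₚ scaleₚ a r)
  scale-+ a p r = ⟨ (λ i → trans (coeff-scale a (p +ₚ r) i)
    (trans (cong (a *ℤ_) (coeff-+ p r i))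
    (trans (ℤP.*-distribˡ-+ a _ _)
    (sym (trans (coeff-+ (scaleₚ a p) (scaleₚ a r) i)
      (cong₂ _+ℤ_ (coeff-scale a p i) (coeff-scale a r i))))))) ⟩

  scale-zero : ∀ p → scaleₚ 0ℤ p ≋ []
  scale-zero p = ⟨ coeff-scale 0ℤ p ⟩

  scale-one : ∀ p → scaleₚ 1ℤ p ≋ p
  scale-one p = ⟨ (λ i → trans (coeff-scale 1ℤ p i) (ℤP.*-identityˡ _)) ⟩

  scale-scale : ∀ a b p → scaleₚ a (scaleₚ b p) ≋ scaleₚ (a *ℤ b) p
  scale-scale a b p = ⟨ (λ i → trans (coeff-scale a (scaleₚ b p) i)
    (trans (cong (a *ℤ_) (coeff-scale b p i))
    (trans (sym (ℤP.*-assoc a b _)) (sym (coeff-scale (a *ℤ b) p i))))) ⟩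

  -- Congruence of multiplication, one coefficient at a time: coefficient
  -- i+1 of p·r only involves p₀ and (tail p)·r.
  *-congˡ-coeff : ∀ r i p p' → p ≋ p' → coeff (p *ₚ r) i ≡ coeff (p' *ₚ r) i
  *-congˡ-coeff r zero p p' e =
    trans (coeff-*-zero p r) (trans (cong (_*ℤ coeff r 0) (un e 0)) (sym (coeff-*-zero p' r)))
  *-congˡ-coeff r (suc i) p p' e = trans (coeff-*-suc p r i)
    (trans (cong₂ _+ℤ_ (cong (_*ℤ coeff r (suc i)) (un e 0))
                       (*-congˡ-coeff r i (tail p) (tail p') (tail-cong e)))
    (sym (coeff-*-suc p' r i)))

  *-congʳ-coeff : ∀ r r' → r ≋ r' → ∀ i p → coeff (p *ₚ r) i ≡ coeff (p *ₚ r') i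
  *-congʳ-coeff r r' e zero p =
    trans (coeff-*-zero p r) (trans (cong (coeff p 0 *ℤ_) (un e 0)) (sym (coeff-*-zero p r')))
  *-congʳ-coeff r r' e (suc i) p = trans (coeff-*-suc p r i)
    (trans (cong₂ _+ℤ_ (cong (coeff p 0 *ℤ_) (un e (suc i))) (*-congʳ-coeff r r' e i (tail p)))
    (sym (coeff-*-suc p r' i)))

  *-cong : ∀ {p p' r r'} → p ≋ p' → r ≋ r' → (p *ₚ r) ≋ (p' *ₚ r')
  *-cong {p} {p'} {r} {r'} e f =
    ⟨ (λ i → trans (*-congˡ-coeff r i p p' e) (*-congʳ-coeff r r' f i p')) ⟩

  *-zeroʳ : ∀ p → (p *ₚ []) ≋ []
  *-zeroʳ []      = ≋-refl
  *-zeroʳ (a ∷ p) = zero∷ (*-zeroʳ p)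

  *-∷ʳ : ∀ p b r → (p *ₚ (b ∷ r)) ≋ (scaleₚ b p +ₚ (0ℤ ∷ (p *ₚ r)))
  *-∷ʳ []      b r = ≋-sym (zero∷ ≋-refl)
  *-∷ʳ (a ∷ p) b r = ∷-cong (trans (ℤP.+-identityʳ _) (trans (ℤP.*-comm a b) (sym (ℤP.+-identityʳ _))))
    (≋-trans (+-cong (≋-refl {scaleₚ a r}) (*-∷ʳ p b r))
    (≋-trans (≋-sym (+-assoc (scaleₚ a r) (scaleₚ b p) _))
    (≋-trans (+-cong (+-comm (scaleₚ a r) (scaleₚ b p)) ≋-refl)
    (+-assoc (scaleₚ b p) (scaleₚ a r) _))))

  *-comm : ∀ p r → (p *ₚ r) ≋ (r *ₚ p)
  *-comm []      r       = ≋-sym (*-zeroʳ r)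
  *-comm (a ∷ p) []      = *-zeroʳ (a ∷ p)
  *-comm (a ∷ p) (b ∷ r) = ∷-cong (cong (_+ℤ 0ℤ) (ℤP.*-comm a b))
    (≋-trans (+-cong (≋-refl {scaleₚ a r}) (*-∷ʳ p b r))
    (≋-trans (≋-sym (+-assoc (scaleₚ a r) (scaleₚ b p) _))
    (≋-trans (+-cong (+-comm (scaleₚ a r) (scaleₚ b p)) (∷-cong refl (*-comm p r)))
    (≋-trans (+-assoc (scaleₚ b p) (scaleₚ a r) _)
    (+-cong (≋-refl {scaleₚ b p}) (≋-sym (*-∷ʳ r a p)))))))

  *-distribˡ : ∀ p r s → (p *ₚ (r +ₚ s)) ≋ ((p *ₚ r) +ₚ (p *ₚ s))
  *-distribˡ []      r s = ≋-refl
  *-distribˡ (a ∷ p) r s =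
    ≋-trans (+-cong (scale-+ a r s) (∷-cong refl (*-distribˡ p r s)))
    (+-interchange (scaleₚ a r) (scaleₚ a s) (0ℤ ∷ (p *ₚ r)) (0ℤ ∷ (p *ₚ s)))

  *-distribʳ : ∀ s p r → ((p +ₚ r) *ₚ s) ≋ ((p *ₚ s) +ₚ (r *ₚ s))
  *-distribʳ s p r = ≋-trans (*-comm (p +ₚ r) s)
    (≋-trans (*-distribˡ s p r) (+-cong (*-comm s p) (*-comm s r)))

  scale-* : ∀ a r s → (scaleₚ a r *ₚ s) ≋ scaleₚ a (r *ₚ s)
  scale-* a []      s = ≋-refl
  scale-* a (b ∷ r) s =
    ≋-trans (+-cong (≋-sym (scale-scale a b s)) (∷-cong (sym (ℤP.*-zeroʳ a)) (scale-* a r s)))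
    (≋-sym (scale-+ a (scaleₚ b s) (0ℤ ∷ (r *ₚ s))))

  shift-* : ∀ p s → ((0ℤ ∷ p) *ₚ s) ≋ (0ℤ ∷ (p *ₚ s))
  shift-* p s = +-cong (scale-zero s) ≋-refl

  *-assoc : ∀ p r s → ((p *ₚ r) *ₚ s) ≋ (p *ₚ (r *ₚ s))
  *-assoc []      r s = ≋-refl
  *-assoc (a ∷ p) r s =
    ≋-trans (*-distribʳ s (scaleₚ a r) (0ℤ ∷ (p *ₚ r)))
    (+-cong (scale-* a r s) (≋-trans (shift-* (p *ₚ r) s) (∷-cong refl (*-assoc p r s))))

  *-identityˡ : ∀ p → (oneₚ *ₚ p) ≋ p
  *-identityˡ p = ≋-trans (+-cong (scale-one p) (zero∷ ≋-refl)) (+-identityʳ p)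

  *-identityʳ : ∀ p → (p *ₚ oneₚ) ≋ p
  *-identityʳ p = ≋-trans (*-comm p oneₚ) (*-identityˡ p)

  polyRing : CommutativeRing _ _
  polyRing = record
    { Carrier = Poly ; _≈_ = _≋_ ; _+_ = _+ₚ_ ; _*_ = _*ₚ_ ; -_ = negₚ ; 0# = [] ; 1# = oneₚ
    ; isCommutativeRing = record
      { isRing = record
        { +-isAbelianGroup = record
          { isGroup = record
            { isMonoid = record
              { isSemigroup = record
                { isMagma = record
                  { isEquivalence = record { refl = ≋-refl ; sym = ≋-sym ; trans = ≋-trans }
                  ; ∙-cong = +-cong }
                ; assoc = +-assoc }
              ; identity = (λ p → ≋-refl) , +-identityʳ }
            ; inverse = +-inverseˡ , +-inverseʳ
            ; ⁻¹-cong = neg-cong }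
          ; comm = +-comm }
        ; *-cong = *-cong
        ; *-assoc = *-assoc
        ; *-identity = *-identityˡ , *-identityʳ
        ; distrib = *-distribˡ , *-distribʳ }
      ; *-comm = *-comm }
    }

module FiniteSums {c ℓ} (R : CommutativeRing c ℓ) where

  open CommutativeRing R hiding (zero)
  open import Algebra.Solver.Ring.NaturalCoefficients.Default commutativeSemiring
  open import Relation.Binary.Reasoning.Setoid setoid

  ≡⇒≈ : ∀ {x y} → x ≡ y → x ≈ y
  ≡⇒≈ Eq.refl = refl

  Σ : ℕ → (ℕ → Carrier) → Carrier
  Σ zero    f = 0#
  Σ (suc N) f = f 0 + Σ N (λ k → f (suc k))

  Σ-cong< : ∀ N {f g} → (∀ k → k < N → f k ≈ g k) → Σ N f ≈ Σ N g
  Σ-cong< zero    h = refl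
  Σ-cong< (suc N) h = +-cong (h 0 (s≤s z≤n)) (Σ-cong< N (λ k k<N → h (suc k) (s≤s k<N)))

  Σ-cong : ∀ N {f g} → (∀ k → f k ≈ g k) → Σ N f ≈ Σ N g
  Σ-cong N h = Σ-cong< N (λ k _ → h k)

  Σ-zero : ∀ N {f} → (∀ k → f k ≈ 0#) → Σ N f ≈ 0#
  Σ-zero zero    h = refl
  Σ-zero (suc N) h = trans (+-cong (h 0) (Σ-zero N (λ k → h (suc k)))) (+-identityˡ 0#)

  Σ-+ : ∀ N f g → Σ N (λ k → f k + g k) ≈ Σ N f + Σ N g
  Σ-+ zero    f g = sym (+-identityˡ 0#)
  Σ-+ (suc N) f g = trans (+-congˡ (Σ-+ N _ _))
    (solve 4 (λ a b x y → (a :+ b) :+ (x :+ y) := (a :+ x) :+ (b :+ y)) refl (f 0) (g 0) (Σ N _) (Σ N _))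

  Σ-*ˡ : ∀ N a f → a * Σ N f ≈ Σ N (λ k → a * f k)
  Σ-*ˡ zero    a f = zeroʳ a
  Σ-*ˡ (suc N) a f = trans (distribˡ a (f 0) _) (+-congˡ (Σ-*ˡ N a _))

  Σ-*ʳ : ∀ N a f → Σ N f * a ≈ Σ N (λ k → f k * a)
  Σ-*ʳ N a f = trans (*-comm _ a) (trans (Σ-*ˡ N a f) (Σ-cong N (λ k → *-comm a (f k))))

  Σ-last : ∀ N f → Σ (suc N) f ≈ Σ N f + f N
  Σ-last zero    f = +-comm (f 0) 0#
  Σ-last (suc N) f = trans (+-congˡ (Σ-last N (λ k → f (suc k)))) (sym (+-assoc (f 0) _ _))

  Σ-swap : ∀ N M (f : ℕ → ℕ → Carrier) →
    Σ N (λ i → Σ M (λ j → f i j)) ≈ Σ M (λ j → Σ N (λ i → f i j))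
  Σ-swap zero    M f = sym (Σ-zero M (λ _ → refl))
  Σ-swap (suc N) M f = trans (+-congˡ (Σ-swap N M (λ i j → f (suc i) j)))
    (sym (Σ-+ M (λ j → f 0 j) (λ j → Σ N (λ i → f (suc i) j))))

  Σ-reverse : ∀ N f → Σ N f ≈ Σ N (λ k → f (N ∸ suc k))
  Σ-reverse zero    f = refl
  Σ-reverse (suc N) f = trans (Σ-last N f) (trans (+-comm _ _) (+-congˡ (Σ-reverse N f)))

  double : ℕ → ℕ
  double zero    = zero
  double (suc j) = suc (suc (double j))

  double-∸ : ∀ m j → j ≤ m → double m ∸ double j ≡ double (m ∸ j)
  double-∸ m       zero    _         = Eq.refl
  double-∸ (suc m) (suc j) (s≤s j≤m) = double-∸ m j j≤m

  Σ-even : ∀ j h → (∀ i → h (suc (double i)) ≈ 0#) →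
    Σ (suc (double j)) h ≈ Σ (suc j) (λ i → h (double i))
  Σ-even zero    h odd = refl
  Σ-even (suc j) h odd = +-congˡ (begin
    h 1 + Σ (suc (double j)) (λ k → h (suc (suc k)))
      ≈⟨ +-cong (odd 0) (Σ-even j (λ k → h (suc (suc k))) (λ i → odd (suc i))) ⟩
    0# + Σ (suc j) (λ i → h (double (suc i)))
      ≈⟨ +-identityˡ _ ⟩
    Σ (suc j) (λ i → h (double (suc i))) ∎)

  δ : ℕ → ℕ → Carrier
  δ zero    zero    = 1#
  δ zero    (suc b) = 0#
  δ (suc a) zero    = 0#
  δ (suc a) (suc b) = δ a b

  δ-sym : ∀ a b → δ a b ≡ δ b a
  δ-sym zero    zero    = Eq.refl
  δ-sym zero    (suc b) = Eq.refl
  δ-sym (suc a) zero    = Eq.refl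
  δ-sym (suc a) (suc b) = δ-sym a b

  δ-diagonal : ∀ a → δ a a ≡ 1#
  δ-diagonal zero    = Eq.refl
  δ-diagonal (suc a) = δ-diagonal a

  δ-off-diagonal : ∀ a b → ¬ a ≡ b → δ a b ≡ 0#
  δ-off-diagonal zero    zero    a≢b = ⊥-elim (a≢b Eq.refl)
  δ-off-diagonal zero    (suc b) a≢b = Eq.refl
  δ-off-diagonal (suc a) zero    a≢b = Eq.refl
  δ-off-diagonal (suc a) (suc b) a≢b = δ-off-diagonal a b (λ a≡b → a≢b (cong suc a≡b))

  δ-weight : ∀ (F : ℕ → Carrier) a b → F a * δ a b ≈ F b * δ a b
  δ-weight F zero    zero    = refl
  δ-weight F zero    (suc b) = trans (zeroʳ _) (sym (zeroʳ _))
  δ-weight F (suc a) zero    = trans (zeroʳ _) (sym (zeroʳ _))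
  δ-weight F (suc a) (suc b) = δ-weight (λ k → F (suc k)) a b

  Σ-δ : ∀ a N g → a < N → Σ N (λ k → δ a k * g k) ≈ g a
  Σ-δ zero    (suc N) g _ =
    trans (+-cong (*-identityˡ (g 0)) (Σ-zero N (λ k → zeroˡ _))) (+-identityʳ _)
  Σ-δ (suc a) (suc N) g (s≤s a<N) =
    trans (+-cong (zeroˡ (g 0)) (Σ-δ a N (λ k → g (suc k)) a<N)) (+-identityˡ _)

module Stieltjes {c ℓ} (R : CommutativeRing c ℓ) (q : CommutativeRing.Carrier R) where

  open CommutativeRing R hiding (zero)
  open FiniteSums R
  open import Algebra.Solver.Ring.NaturalCoefficients.Default commutativeSemiring
  open import Algebra.Properties.Ring ring using (-‿distribˡ-*)
  open import Relation.Binary.Reasoning.Setoid setoid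
  open import Data.Nat.Tactic.RingSolver using (solve-∀)

  pw : ℕ → Carrier
  pw zero    = 1#
  pw (suc k) = q * pw k

  pw-+ : ∀ a b → pw (a ℕ.+ b) ≈ pw a * pw b
  pw-+ zero    b = sym (*-identityˡ (pw b))
  pw-+ (suc a) b = trans (*-congˡ (pw-+ a b)) (sym (*-assoc q (pw a) (pw b)))

  pw-≡ : ∀ {a b} → a ≡ b → pw a ≈ pw b
  pw-≡ e = ≡⇒≈ (cong pw e)

  lower : (ℕ → Carrier) → ℕ → Carrier
  lower f zero    = 0#
  lower f (suc k) = f k

  Σ-lower : ∀ N (f w : ℕ → Carrier) → Σ (suc N) (λ k → lower f k * w k) ≈ Σ N (λ k → f k * w (suc k))
  Σ-lower N f w = trans (+-congʳ (zeroˡ (w 0))) (+-identityˡ _)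

  -- T s n k: weighted paths of length n from height 0 to height k, a down
  -- step ending at height h weighing q^(s+h).  The recursion is on the last
  -- step.
  T : ℕ → ℕ → ℕ → Carrier
  T s zero    zero    = 1#
  T s zero    (suc k) = 0#
  T s (suc n) zero    = pw s * T s n 1
  T s (suc n) (suc k) = T s n k + pw (s ℕ.+ suc k) * T s n (suc (suc k))

  T-step : ∀ s n k → T s (suc n) k ≈ lower (T s n) k + pw (s ℕ.+ k) * T s n (suc k)
  T-step s n zero    = trans (*-congʳ (pw-≡ (Eq.sym (ℕP.+-identityʳ s)))) (sym (+-identityˡ _))
  T-step s n (suc k) = refl

  T-empty : ∀ s k → T s 0 k ≈ δ 0 k
  T-empty s zero    = refl
  T-empty s (suc k) = refl

  -- No path of length n reaches a height above n: T is lower triangular.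
  T-vanish : ∀ s n k → n < k → T s n k ≈ 0#
  T-vanish s zero    (suc k) _         = refl
  T-vanish s (suc n) (suc k) (s≤s n<k) = trans
    (+-cong (T-vanish s n k n<k)
            (trans (*-congˡ (T-vanish s n (suc (suc k)) (ℕP.m≤n⇒m≤1+n (ℕP.m≤n⇒m≤1+n n<k)))) (zeroʳ _)))
    (+-identityʳ 0#)

  -- Length and final height of a path have the same parity.
  T-odd : ∀ s n k j → n ℕ.+ k ≡ suc (double j) → T s n k ≈ 0#
  T-odd s zero    (suc k) j       e = refl
  T-odd s (suc n) zero    j       e =
    trans (*-congˡ (T-odd s n 1 j (Eq.trans (ℕP.+-suc n 0) e))) (zeroʳ _)
  T-odd s (suc n) (suc k) zero    e =
    ⊥-elim (ℕP.1+n≢0 (Eq.trans (Eq.sym (ℕP.+-suc n k)) (ℕP.suc-injective e)))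
  T-odd s (suc n) (suc k) (suc j) e = trans
    (+-cong (T-odd s n k j n+k≡2j+1)
            (trans (*-congˡ (T-odd s n (suc (suc k)) (suc j) n+k+2≡2j+3)) (zeroʳ _)))
    (+-identityʳ 0#)
    where
    n+k≡2j+1 : n ℕ.+ k ≡ suc (double j)
    n+k≡2j+1 = ℕP.suc-injective
      (Eq.trans (Eq.sym (ℕP.+-suc n k)) (ℕP.suc-injective e))
    n+k+2≡2j+3 : n ℕ.+ suc (suc k) ≡ suc (double (suc j))
    n+k+2≡2j+3 = Eq.trans (ℕP.+-suc n (suc k))
      (cong suc (Eq.trans (ℕP.+-suc n k) (cong suc n+k≡2j+1)))

  T-odd-length : ∀ s j → T s (suc (double j)) 0 ≈ 0#
  T-odd-length s j = T-odd s (suc (double j)) 0 j (ℕP.+-identityʳ _)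

  conv : (ℕ → Carrier) → (ℕ → Carrier) → ℕ → Carrier
  conv f g n = Σ (suc n) (λ a → f a * g (n ∸ a))

  conv-suc : ∀ (f g : ℕ → Carrier) n → conv f g (suc n) ≈ conv f (λ b → g (suc b)) n + f (suc n) * g 0
  conv-suc f g n = trans (Σ-last (suc n) (λ a → f a * g (suc n ∸ a))) (+-cong
    (Σ-cong< (suc n) (λ a a<1+n → *-congˡ {f a} (≡⇒≈ (cong g (ℕP.+-∸-assoc 1 (ℕP.≤-pred a<1+n))))))
    (*-congˡ (≡⇒≈ (cong g (ℕP.n∸n≡0 n)))))

  conv-scale : ∀ (f g : ℕ → Carrier) x n → conv f (λ b → x * g b) n ≈ x * conv f g n
  conv-scale f g x n = trans
    (Σ-cong (suc n) (λ a → solve 3 (λ u x v → u :* (x :* v) := x :* (u :* v)) refl (f a) x (g (n ∸ a))))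
    (sym (Σ-*ˡ (suc n) x (λ a → f a * g (n ∸ a))))

  conv-linear : ∀ (f g h : ℕ → Carrier) x n → conv f (λ b → g b + x * h b) n ≈ conv f g n + x * conv f h n
  conv-linear f g h x n = begin
    conv f (λ b → g b + x * h b) n
      ≈⟨ Σ-cong (suc n) (λ a → distribˡ (f a) (g (n ∸ a)) (x * h (n ∸ a))) ⟩
    Σ (suc n) (λ a → f a * g (n ∸ a) + f a * (x * h (n ∸ a)))
      ≈⟨ Σ-+ (suc n) (λ a → f a * g (n ∸ a)) (λ a → f a * (x * h (n ∸ a))) ⟩
    conv f g n + conv f (λ b → x * h b) n
      ≈⟨ +-congˡ (conv-scale f h x n) ⟩
    conv f g n + x * conv f h n ∎

  -- (1a) First-return decomposition: a path of length n+1 ending at height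
  -- k+1 splits at its last visit to height 0 into a return path and a path
  -- of height ≥ 1, whose weights use q^(s+1+h).
  first-return : ∀ s n k →
    T s (suc n) (suc k) ≈ conv (λ a → T s a 0) (λ b → T (suc s) b k) n
  first-return s zero k =
    +-cong (trans (trans (T-empty s k) (sym (T-empty (suc s) k))) (sym (*-identityˡ _))) (zeroʳ _)
  first-return s (suc n) zero = begin
    T s (suc n) 0 + pw (s ℕ.+ 1) * T s (suc n) 2
      ≈⟨ +-cong (sym (*-identityʳ _)) (*-cong (pw-≡ (ℕP.+-comm s 1)) (first-return s n 1)) ⟩
    f (suc n) * 1# + pw (suc s) * conv f g₁ n
      ≈⟨ +-comm _ _ ⟩
    pw (suc s) * conv f g₁ n + f (suc n) * 1#
      ≈⟨ +-congʳ (sym (conv-scale f g₁ (pw (suc s)) n)) ⟩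
    conv f (λ b → pw (suc s) * g₁ b) n + f (suc n) * 1#
      ≈⟨ sym (conv-suc f (λ b → T (suc s) b 0) n) ⟩
    conv f (λ b → T (suc s) b 0) (suc n) ∎
    where
    f  = λ a → T s a 0
    g₁ = λ b → T (suc s) b 1
  first-return s (suc n) (suc k) = begin
    T s (suc n) (suc k) + pw (s ℕ.+ suc (suc k)) * T s (suc n) (suc (suc (suc k)))
      ≈⟨ +-cong (first-return s n k) (*-cong (pw-≡ (ℕP.+-suc s (suc k))) (first-return s n (suc (suc k)))) ⟩
    conv f gₖ n + x * conv f gₖ₊₂ n
      ≈⟨ sym (conv-linear f gₖ gₖ₊₂ x n) ⟩
    conv f (λ b → gₖ b + x * gₖ₊₂ b) n
      ≈⟨ sym (trans (+-congˡ (zeroʳ (f (suc n)))) (+-identityʳ _)) ⟩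
    conv f (λ b → gₖ b + x * gₖ₊₂ b) n + f (suc n) * 0#
      ≈⟨ sym (conv-suc f (λ b → T (suc s) b (suc k)) n) ⟩
    conv f (λ b → T (suc s) b (suc k)) (suc n) ∎
    where
    f   = λ a → T s a 0
    gₖ   = λ b → T (suc s) b k
    gₖ₊₂ = λ b → T (suc s) b (suc (suc k))
    x   = pw (suc s ℕ.+ suc k)

  module Catalan (Cat : ℕ → Carrier) (Cat-zero : Cat 0 ≈ 1#)
                 (Cat-suc : ∀ n → Cat (suc n) ≈ Σ (suc n) (λ k → pw k * Cat k * Cat (n ∸ k))) where

    catalan-term : ℕ → ℕ → Carrier
    catalan-term n k = pw k * Cat k * Cat (n ∸ k)

    EvenLength : ℕ → Set ℓ
    EvenLength j = ∀ s → T s (double j) 0 ≈ pw (s ℕ.* j) * Cat j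

    even-length-zero : EvenLength 0
    even-length-zero s = sym (trans (*-cong (pw-≡ (ℕP.*-zeroʳ s)) Cat-zero) (*-identityˡ 1#))

    exponent : ∀ s i t → s ℕ.+ (s ℕ.* i ℕ.+ suc s ℕ.* t) ≡ s ℕ.* suc (i ℕ.+ t) ℕ.+ t
    exponent = solve-∀

    -- A return path of length 2(j+1) starts with an up step; splitting it by
    -- first-return gives two shorter return paths of lengths 2i and 2(j-i),
    -- of weights q^(s i) Cat_i and q^((s+1)(j-i)) Cat_(j-i).
    even-term : ∀ j → (∀ i → i ≤ j → EvenLength i) → ∀ s i → i ≤ j →
      pw s * (T s (double i) 0 * T (suc s) (double j ∸ double i) 0)
        ≈ pw (s ℕ.* suc j) * catalan-term j (j ∸ i)
    even-term j below s i i≤j = begin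
      pw s * (T s (double i) 0 * T (suc s) (double j ∸ double i) 0)
        ≈⟨ *-congˡ (*-cong (below i i≤j s)
             (trans (≡⇒≈ (cong (λ m → T (suc s) m 0) (double-∸ j i i≤j))) (below t (ℕP.m∸n≤m j i) (suc s)))) ⟩
      pw s * ((pw (s ℕ.* i) * Cat i) * (pw (suc s ℕ.* t) * Cat t))
        ≈⟨ solve 5 (λ a b x y z → a :* ((b :* x) :* (y :* z)) := (a :* (b :* y)) :* (x :* z)) refl
             (pw s) (pw (s ℕ.* i)) (Cat i) (pw (suc s ℕ.* t)) (Cat t) ⟩
      (pw s * (pw (s ℕ.* i) * pw (suc s ℕ.* t))) * (Cat i * Cat t)
        ≈⟨ *-congʳ (sym (trans (pw-+ s _) (*-congˡ (pw-+ (s ℕ.* i) _)))) ⟩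
      pw (s ℕ.+ (s ℕ.* i ℕ.+ suc s ℕ.* t)) * (Cat i * Cat t)
        ≈⟨ *-congʳ (trans (pw-≡ (Eq.trans (exponent s i t) (cong (λ m → s ℕ.* suc m ℕ.+ t) (ℕP.m+[n∸m]≡n i≤j))))
                          (pw-+ (s ℕ.* suc j) t)) ⟩
      (pw (s ℕ.* suc j) * pw t) * (Cat i * Cat t)
        ≈⟨ solve 4 (λ a b x y → (a :* b) :* (x :* y) := a :* (b :* y :* x)) refl
             (pw (s ℕ.* suc j)) (pw t) (Cat i) (Cat t) ⟩
      pw (s ℕ.* suc j) * (pw t * Cat t * Cat i)
        ≈⟨ *-congˡ (*-congˡ (≡⇒≈ (cong Cat (Eq.sym (ℕP.m∸[m∸n]≡n i≤j))))) ⟩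
      pw (s ℕ.* suc j) * catalan-term j t ∎
      where t = j ∸ i

    even-length-step : ∀ j → (∀ i → i ≤ j → EvenLength i) → EvenLength (suc j)
    even-length-step j below s = begin
      pw s * T s (suc (double j)) 1
        ≈⟨ *-congˡ (first-return s (double j) 0) ⟩
      pw s * Σ (suc (double j)) h
        ≈⟨ *-congˡ (Σ-even j h (λ i → trans (*-congʳ (T-odd-length s i)) (zeroˡ _))) ⟩
      pw s * Σ (suc j) (λ i → h (double i))
        ≈⟨ Σ-*ˡ (suc j) (pw s) (λ i → h (double i)) ⟩
      Σ (suc j) (λ i → pw s * h (double i))
        ≈⟨ Σ-cong< (suc j) (λ i i<1+j → even-term j below s i (ℕP.≤-pred i<1+j)) ⟩
      Σ (suc j) (λ i → pw (s ℕ.* suc j) * catalan-term j (j ∸ i))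
        ≈⟨ sym (Σ-*ˡ (suc j) (pw (s ℕ.* suc j)) (λ i → catalan-term j (j ∸ i))) ⟩
      pw (s ℕ.* suc j) * Σ (suc j) (λ i → catalan-term j (j ∸ i))
        ≈⟨ *-congˡ (sym (Σ-reverse (suc j) (catalan-term j))) ⟩
      pw (s ℕ.* suc j) * Σ (suc j) (catalan-term j)
        ≈⟨ *-congˡ (sym (Cat-suc j)) ⟩
      pw (s ℕ.* suc j) * Cat (suc j) ∎
      where
      h : ℕ → Carrier
      h a = T s a 0 * T (suc s) (double j ∸ a) 0

    even-length-below : ∀ m j → j ≤ m → EvenLength j
    even-length-below zero    zero z≤n = even-length-zero
    even-length-below (suc m) j j≤1+m with ℕP.m≤n⇒m<n∨m≡n j≤1+m
    ... | inj₁ (s≤s j≤m) = even-length-below m j j≤m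
    ... | inj₂ Eq.refl   = even-length-step m (even-length-below m)

    T-even-length : ∀ j → T 0 (double j) 0 ≈ Cat j
    T-even-length j = trans (even-length-below j j ℕP.≤-refl 0) (*-identityˡ (Cat j))

  T₀ : ℕ → ℕ → Carrier
  T₀ = T 0

  -- D k = q^(0+1+…+(k-1)), the weight of the descent from height k to 0.
  triangle : ℕ → ℕ
  triangle zero    = zero
  triangle (suc k) = k ℕ.+ triangle k

  D : ℕ → Carrier
  D k = pw (triangle k)

  D-suc : ∀ k → D (suc k) ≈ pw k * D k
  D-suc k = pw-+ k (triangle k)

  row-shift : ∀ i N (w : ℕ → Carrier) →
    Σ (suc N) (λ k → T₀ (suc i) k * w k)
      ≈ Σ N (λ k → T₀ i k * w (suc k)) + Σ (suc N) (λ k → pw k * T₀ i (suc k) * w k)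
  row-shift i N w = begin
    Σ (suc N) (λ k → T₀ (suc i) k * w k)
      ≈⟨ Σ-cong (suc N) (λ k → trans (*-congʳ (T-step 0 i k)) (distribʳ (w k) _ _)) ⟩
    Σ (suc N) (λ k → lower (T₀ i) k * w k + pw k * T₀ i (suc k) * w k)
      ≈⟨ Σ-+ (suc N) (λ k → lower (T₀ i) k * w k) (λ k → pw k * T₀ i (suc k) * w k) ⟩
    Σ (suc N) (λ k → lower (T₀ i) k * w k) + Σ (suc N) (λ k → pw k * T₀ i (suc k) * w k)
      ≈⟨ +-congʳ (Σ-lower N (T₀ i) w) ⟩
    Σ N (λ k → T₀ i k * w (suc k)) + Σ (suc N) (λ k → pw k * T₀ i (suc k) * w k) ∎

  -- Using D (k+1) = q^k D k, an up step of one path is traded for a down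
  -- step of the other; the extra last term is assumed to vanish.
  cross-term : ∀ a b N → pw N * T₀ b (suc N) * (D N * T₀ a N) ≈ 0# →
    Σ N (λ k → T₀ a k * (D (suc k) * T₀ b (suc k)))
      ≈ Σ (suc N) (λ k → pw k * T₀ b (suc k) * (D k * T₀ a k))
  cross-term a b N last≈0 = begin
    Σ N (λ k → T₀ a k * (D (suc k) * T₀ b (suc k)))
      ≈⟨ Σ-cong N (λ k → trans (*-congˡ (*-congʳ (D-suc k)))
           (solve 4 (λ x p d y → x :* ((p :* d) :* y) := p :* y :* (d :* x)) refl
              (T₀ a k) (pw k) (D k) (T₀ b (suc k)))) ⟩
    Σ N g
      ≈⟨ sym (trans (+-congˡ last≈0) (+-identityʳ _)) ⟩
    Σ N g + g N
      ≈⟨ sym (Σ-last N g) ⟩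
    Σ (suc N) g ∎
    where
    g : ℕ → Carrier
    g k = pw k * T₀ b (suc k) * (D k * T₀ a k)

  -- (2) H = T₀ · diag(D) · T₀ᵀ, where H i j = T₀ (i+j) 0: the bilinear form
  -- Σ_k T₀ i k D_k T₀ j k only depends on i + j.
  hankel-step : ∀ i j N → i < N →
    Σ (suc N) (λ k → T₀ (suc i) k * (D k * T₀ j k))
      ≈ Σ (suc N) (λ k → T₀ i k * (D k * T₀ (suc j) k))
  hankel-step i j N i<N = begin
    Σ (suc N) (λ k → T₀ (suc i) k * (D k * T₀ j k))
      ≈⟨ row-shift i N (λ k → D k * T₀ j k) ⟩
    A₁ + A₂
      ≈⟨ +-cong (cross-term i j N T₀iN-term) (sym (cross-term j i N T₀i[1+N]-term)) ⟩
    B₂ + B₁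
      ≈⟨ +-comm B₂ B₁ ⟩
    B₁ + B₂
      ≈⟨ sym (row-shift j N (λ k → D k * T₀ i k)) ⟩
    Σ (suc N) (λ k → T₀ (suc j) k * (D k * T₀ i k))
      ≈⟨ Σ-cong (suc N) (λ k → solve 3 (λ a d b → a :* (d :* b) := b :* (d :* a)) refl
                                   (T₀ (suc j) k) (D k) (T₀ i k)) ⟩
    Σ (suc N) (λ k → T₀ i k * (D k * T₀ (suc j) k)) ∎
    where
    A₁ = Σ N (λ k → T₀ i k * (D (suc k) * T₀ j (suc k)))
    A₂ = Σ (suc N) (λ k → pw k * T₀ i (suc k) * (D k * T₀ j k))
    B₁ = Σ N (λ k → T₀ j k * (D (suc k) * T₀ i (suc k)))
    B₂ = Σ (suc N) (λ k → pw k * T₀ j (suc k) * (D k * T₀ i k))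
    T₀iN-term : pw N * T₀ j (suc N) * (D N * T₀ i N) ≈ 0#
    T₀iN-term = trans (*-congˡ (trans (*-congˡ (T-vanish 0 i N i<N)) (zeroʳ _))) (zeroʳ _)
    T₀i[1+N]-term : pw N * T₀ i (suc N) * (D N * T₀ j N) ≈ 0#
    T₀i[1+N]-term = trans (*-congʳ (trans (*-congˡ (T-vanish 0 i (suc N) (ℕP.m≤n⇒m≤1+n i<N))) (zeroʳ _)))
                          (zeroˡ _)

  hankel-factorisation : ∀ i j N → i < N → Σ N (λ k → T₀ i k * (D k * T₀ j k)) ≈ T₀ (i ℕ.+ j) 0
  hankel-factorisation zero j (suc N) _ = trans
    (+-cong (trans (*-identityˡ _) (*-identityˡ _)) (Σ-zero N (λ k → zeroˡ _)))
    (+-identityʳ _)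
  hankel-factorisation (suc i) j (suc N) (s≤s i<N) = begin
    Σ (suc N) (λ k → T₀ (suc i) k * (D k * T₀ j k))
      ≈⟨ hankel-step i j N i<N ⟩
    Σ (suc N) (λ k → T₀ i k * (D k * T₀ (suc j) k))
      ≈⟨ hankel-factorisation i (suc j) (suc N) (ℕP.m≤n⇒m≤1+n i<N) ⟩
    T₀ (i ℕ.+ suc j) 0
      ≈⟨ ≡⇒≈ (cong (λ m → T₀ m 0) (ℕP.+-suc i j)) ⟩
    T₀ (suc i ℕ.+ j) 0 ∎

  -- (3) The inverse of T₀: P n k is the coefficient of x^k in the monic
  -- orthogonal polynomial p_n, where p_{n+2} = x p_{n+1} - q^n p_n.
  P : ℕ → ℕ → Carrier
  P zero                k       = δ 0 k
  P (suc zero)          k       = δ 1 k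
  P (suc (suc n))       zero    = - (pw n * P n zero)
  P (suc (suc n))       (suc k) = P (suc n) k - pw n * P n (suc k)

  P-step : ∀ n k → P (suc (suc n)) k ≈ lower (P (suc n)) k + (- pw n) * P n k
  P-step n zero    = trans (-‿distribˡ-* (pw n) (P n 0)) (sym (+-identityˡ _))
  P-step n (suc k) = +-congˡ (-‿distribˡ-* (pw n) (P n (suc k)))

  P-vanish : ∀ n k → n < k → P n k ≈ 0#
  P-vanish zero          k       n<k = ≡⇒≈ (δ-off-diagonal 0 k (ℕP.<⇒≢ n<k))
  P-vanish (suc zero)    k       n<k = ≡⇒≈ (δ-off-diagonal 1 k (ℕP.<⇒≢ n<k))
  P-vanish (suc (suc n)) (suc k) (s≤s n<k) = trans (P-step n (suc k)) (trans
    (+-cong (P-vanish (suc n) k n<k)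
            (trans (*-congˡ (P-vanish n (suc k) (ℕP.m≤n⇒m≤1+n (ℕP.<⇒≤ n<k)))) (zeroʳ _)))
    (+-identityʳ 0#))

  P-diagonal : ∀ n → P n n ≈ 1#
  P-diagonal zero          = refl
  P-diagonal (suc zero)    = refl
  P-diagonal (suc (suc n)) = trans (P-step n (suc (suc n))) (trans
    (+-cong (P-diagonal (suc n))
            (trans (*-congˡ (P-vanish n (suc (suc n)) (ℕP.n≤1+n (suc n)))) (zeroʳ _)))
    (+-identityʳ 1#))

  T₀-row-one : ∀ m → T₀ 1 m ≈ δ 1 m
  T₀-row-one zero    = zeroʳ _
  T₀-row-one (suc m) = trans (+-cong (T-empty 0 m) (zeroʳ _)) (+-identityʳ _)

  row-times-next : ∀ N (v e : ℕ → Carrier) → (∀ m → Σ N (λ k → v k * T₀ k m) ≈ e m) →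
    ∀ m → Σ N (λ k → v k * T₀ (suc k) m) ≈ lower e m + pw m * e (suc m)
  row-times-next N v e v·T₀≈e m = begin
    Σ N (λ k → v k * T₀ (suc k) m)
      ≈⟨ Σ-cong N (λ k → trans (*-congˡ (T-step 0 k m))
           (solve 4 (λ a x b y → a :* (x :+ b :* y) := a :* x :+ b :* (a :* y)) refl
              (v k) (lower (T₀ k) m) (pw m) (T₀ k (suc m)))) ⟩
    Σ N (λ k → v k * lower (T₀ k) m + pw m * (v k * T₀ k (suc m)))
      ≈⟨ Σ-+ N (λ k → v k * lower (T₀ k) m) (λ k → pw m * (v k * T₀ k (suc m))) ⟩
    Σ N (λ k → v k * lower (T₀ k) m) + Σ N (λ k → pw m * (v k * T₀ k (suc m)))
      ≈⟨ +-cong (lowered m) (trans (sym (Σ-*ˡ N (pw m) _)) (*-congˡ (v·T₀≈e (suc m)))) ⟩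
    lower e m + pw m * e (suc m) ∎
    where
    lowered : ∀ m → Σ N (λ k → v k * lower (T₀ k) m) ≈ lower e m
    lowered zero    = Σ-zero N (λ k → zeroʳ (v k))
    lowered (suc m) = v·T₀≈e m

  lower-δ : ∀ a m → lower (δ a) m ≡ δ (suc a) m
  lower-δ a zero    = Eq.refl
  lower-δ a (suc m) = Eq.refl

  cancel : ∀ x y z → (x + y * z) + (- y) * z ≈ x
  cancel x y z = begin
    (x + y * z) + (- y) * z    ≈⟨ +-congˡ (sym (-‿distribˡ-* y z)) ⟩
    (x + y * z) + - (y * z)    ≈⟨ +-assoc x _ _ ⟩
    x + (y * z + - (y * z))    ≈⟨ +-congˡ (-‿inverseʳ _) ⟩
    x + 0#                     ≈⟨ +-identityʳ x ⟩
    x                          ∎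

  P-T₀-inverse : ∀ n m N → n < N → Σ N (λ k → P n k * T₀ k m) ≈ δ n m
  P-T₀-inverse zero          m N n<N = trans (Σ-δ 0 N (λ k → T₀ k m) n<N) (T-empty 0 m)
  P-T₀-inverse (suc zero)    m N n<N = trans (Σ-δ 1 N (λ k → T₀ k m) n<N) (T₀-row-one m)
  P-T₀-inverse (suc (suc n)) m (suc N) (s≤s n+1<N) = begin
    Σ (suc N) (λ k → P (suc (suc n)) k * T₀ k m)
      ≈⟨ Σ-cong (suc N) (λ k → trans (*-congʳ (P-step n k))
           (solve 4 (λ a c b t → (a :+ c :* b) :* t := a :* t :+ c :* (b :* t)) refl
              (lower (P (suc n)) k) (- pw n) (P n k) (T₀ k m))) ⟩
    Σ (suc N) (λ k → lower (P (suc n)) k * T₀ k m + (- pw n) * (P n k * T₀ k m))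
      ≈⟨ trans (Σ-+ (suc N) (λ k → lower (P (suc n)) k * T₀ k m) (λ k → (- pw n) * (P n k * T₀ k m)))
               (+-congˡ (sym (Σ-*ˡ (suc N) (- pw n) (λ k → P n k * T₀ k m)))) ⟩
    Σ (suc N) (λ k → lower (P (suc n)) k * T₀ k m) + (- pw n) * Σ (suc N) (λ k → P n k * T₀ k m)
      ≈⟨ +-cong (Σ-lower N (P (suc n)) (λ k → T₀ k m))
                (*-congˡ (P-T₀-inverse n m (suc N) (ℕP.m≤n⇒m≤1+n (ℕP.<⇒≤ n+1<N)))) ⟩
    Σ N (λ k → P (suc n) k * T₀ (suc k) m) + (- pw n) * δ n m
      ≈⟨ +-congʳ (row-times-next N (P (suc n)) (δ (suc n))
                    (λ m' → P-T₀-inverse (suc n) m' N n+1<N) m) ⟩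
    (lower (δ (suc n)) m + pw m * δ n m) + (- pw n) * δ n m
      ≈⟨ +-congʳ (+-cong (≡⇒≈ (lower-δ (suc n) m)) (sym (δ-weight pw n m))) ⟩
    (δ (suc (suc n)) m + pw n * δ n m) + (- pw n) * δ n m
      ≈⟨ cancel _ (pw n) (δ n m) ⟩
    δ (suc (suc n)) m ∎

  -- P · H = diag(D) · T₀ᵀ, by (2) and P · T₀ = I.
  P-hankel : ∀ N i l → i < N → Σ N (λ k → P i k * T₀ (k ℕ.+ l) 0) ≈ D i * T₀ l i
  P-hankel N i l i<N = begin
    Σ N (λ k → P i k * T₀ (k ℕ.+ l) 0)
      ≈⟨ Σ-cong< N (λ k k<N → *-congˡ (sym (hankel-factorisation k l N k<N))) ⟩
    Σ N (λ k → P i k * Σ N (λ r → T₀ k r * (D r * T₀ l r)))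
      ≈⟨ Σ-cong N (λ k → Σ-*ˡ N (P i k) (λ r → T₀ k r * (D r * T₀ l r))) ⟩
    Σ N (λ k → Σ N (λ r → P i k * (T₀ k r * (D r * T₀ l r))))
      ≈⟨ Σ-swap N N (λ k r → P i k * (T₀ k r * (D r * T₀ l r))) ⟩
    Σ N (λ r → Σ N (λ k → P i k * (T₀ k r * (D r * T₀ l r))))
      ≈⟨ Σ-cong N (λ r → trans (Σ-cong N (λ k → sym (*-assoc (P i k) (T₀ k r) (D r * T₀ l r))))
                                (sym (Σ-*ʳ N (D r * T₀ l r) (λ k → P i k * T₀ k r)))) ⟩
    Σ N (λ r → Σ N (λ k → P i k * T₀ k r) * (D r * T₀ l r))
      ≈⟨ Σ-cong N (λ r → *-congʳ (P-T₀-inverse i r N i<N)) ⟩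
    Σ N (λ r → δ i r * (D r * T₀ l r))
      ≈⟨ Σ-δ i N (λ r → D r * T₀ l r) i<N ⟩
    D i * T₀ l i ∎

  P-hankel-Pᵀ : ∀ N i j → i < N → j < N →
    Σ N (λ l → Σ N (λ k → P i k * T₀ (k ℕ.+ l) 0) * P j l) ≈ D i * δ i j
  P-hankel-Pᵀ N i j i<N j<N = begin
    Σ N (λ l → Σ N (λ k → P i k * T₀ (k ℕ.+ l) 0) * P j l)
      ≈⟨ Σ-cong< N (λ l l<N → *-congʳ (P-hankel N i l i<N)) ⟩
    Σ N (λ l → (D i * T₀ l i) * P j l)
      ≈⟨ Σ-cong N (λ l → solve 3 (λ d t p → (d :* t) :* p := d :* (p :* t)) refl (D i) (T₀ l i) (P j l)) ⟩
    Σ N (λ l → D i * (P j l * T₀ l i))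
      ≈⟨ sym (Σ-*ˡ N (D i) (λ l → P j l * T₀ l i)) ⟩
    D i * Σ N (λ l → P j l * T₀ l i)
      ≈⟨ *-congˡ (P-T₀-inverse j i N j<N) ⟩
    D i * δ j i
      ≈⟨ *-congˡ (≡⇒≈ (δ-sym j i)) ⟩
    D i * δ i j ∎

open Eq using (refl)
open PolyRing
open import Relation.Binary.Reasoning.Setoid (CommutativeRing.setoid polyRing)

sumF-cong : ∀ N {f g : Fin N → Poly} → (∀ i → f i ≋ g i) → sumF f ≋ sumF g
sumF-cong zero    e = ≋-refl
sumF-cong (suc N) e = +-cong (e zero) (sumF-cong N (λ i → e (suc i)))

sumF-zero : ∀ N {f : Fin N → Poly} → (∀ i → f i ≋ []) → sumF f ≋ []
sumF-zero zero    e = ≋-refl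
sumF-zero (suc N) e = +-cong (e zero) (sumF-zero N (λ i → e (suc i)))

*-by-zero : ∀ x {d} → d ≋ [] → (x *ₚ d) ≋ []
*-by-zero x d≈0 = ≋-trans (*-cong (≋-refl {x}) d≈0) (*-zeroʳ x)

minor : ∀ {N} → Fin (suc N) → Matrix (suc N) (suc N) → Matrix N N
minor i A r c = A (punchIn i r) (suc c)

laplace-tail : ∀ {N} → Matrix (suc N) (suc N) → Poly
laplace-tail {N} A = sumF (λ (i : Fin N) → signₚ (toℕ (suc i)) *ₚ A (suc i) zero *ₚ det (minor (suc i) A))

-- A matrix with a zero first row has determinant 0; and if the first row
-- vanishes off the first column, every minor in the Laplace tail has a
-- zero first row.
mutual
  det-zero-row : ∀ N (A : Matrix (suc N) (suc N)) → (∀ c → A zero c ≋ []) → det A ≋ []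
  det-zero-row N A row₀ = +-cong
    (*-cong (*-by-zero oneₚ (row₀ zero)) ≋-refl)
    (laplace-tail-zero N A (λ c → row₀ (suc c)))

  laplace-tail-zero : ∀ N (A : Matrix (suc N) (suc N)) → (∀ c → A zero (suc c) ≋ []) →
    laplace-tail A ≋ []
  laplace-tail-zero zero    A row₀ = ≋-refl
  laplace-tail-zero (suc N) A row₀ = sumF-zero (suc N) (λ i →
    *-by-zero (signₚ (toℕ (suc i)) *ₚ A (suc i) zero) (det-zero-row N (minor (suc i) A) row₀))

leading-term : ∀ {N} (A : Matrix (suc N) (suc N)) → A zero zero ≋ oneₚ → det (minor zero A) ≋ oneₚ →
  signₚ 0 *ₚ A zero zero *ₚ det (minor zero A) ≋ oneₚ
leading-term A a₀₀≈1 minor≈1 =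
  ≋-trans (*-cong (≋-trans (*-cong (≋-refl {oneₚ}) a₀₀≈1) (*-identityˡ oneₚ)) minor≈1) (*-identityˡ oneₚ)

det-lower-unitriangular : ∀ N (A : Matrix N N) →
  (∀ i j → toℕ i < toℕ j → A i j ≋ []) → (∀ i → A i i ≋ oneₚ) → det A ≋ oneₚ
det-lower-unitriangular zero    A upper diag = ≋-refl
det-lower-unitriangular (suc N) A upper diag = ≋-trans
  (+-cong (leading-term A (diag zero)
             (det-lower-unitriangular N (minor zero A)
                (λ i j i<j → upper (suc i) (suc j) (s≤s i<j)) (λ i → diag (suc i))))
          (laplace-tail-zero N A (λ c → upper zero (suc c) (s≤s z≤n))))
  (+-identityʳ oneₚ)

det-upper-unitriangular : ∀ N (A : Matrix N N) →
  (∀ i j → toℕ j < toℕ i → A i j ≋ []) → (∀ i → A i i ≋ oneₚ) → det A ≋ oneₚ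
det-upper-unitriangular zero    A lower diag = ≋-refl
det-upper-unitriangular (suc N) A lower diag = ≋-trans
  (+-cong (leading-term A (diag zero)
             (det-upper-unitriangular N (minor zero A)
                (λ i j j<i → lower (suc i) (suc j) (s≤s j<i)) (λ i → diag (suc i))))
          (sumF-zero N (λ i → *-cong (*-by-zero (signₚ (toℕ (suc i))) (lower (suc i) zero (s≤s z≤n)))
                                      ≋-refl)))
  (+-identityʳ oneₚ)

X : Poly
X = 0ℤ ∷ 1ℤ ∷ []

open FiniteSums polyRing using (Σ; Σ-cong; Σ-cong<; δ; δ-diagonal; δ-off-diagonal; double)
open Stieltjes polyRing X
  using (pw; pw-+; T₀; T-odd-length; triangle; D; P; P-vanish; P-diagonal; P-hankel-Pᵀ; module Catalan)

qpow-pw : ∀ k → qpow k ≋ pw k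
qpow-pw zero    = ≋-refl
qpow-pw (suc k) = ≋-trans (∷-cong refl (qpow-pw k))
  (≋-sym (≋-trans (+-cong (scale-zero (pw k)) ≋-refl) (∷-cong refl (*-identityˡ (pw k)))))

sumF-Σ : ∀ N (g : ℕ → Poly) → sumF {N} (λ i → g (toℕ i)) ≡ Σ N g
sumF-Σ zero    g = refl
sumF-Σ (suc N) g = cong (g 0 +ₚ_) (sumF-Σ N (λ k → g (suc k)))

-- Cq satisfies the q-Catalan recursion: catList n lists C_0, …, C_n, and
-- each new entry is the sum defining C_{n+1}.
nth-snoc : ∀ (L : List Poly) x k → length L ≡ k → nth k (L ++ x ∷ []) ≡ x
nth-snoc []      x zero    _ = refl
nth-snoc (y ∷ L) x (suc k) e = nth-snoc L x k (ℕP.suc-injective e)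

nth-++ : ∀ (L ys : List Poly) k → k < length L → nth k (L ++ ys) ≡ nth k L
nth-++ (y ∷ L) ys zero    _         = refl
nth-++ (y ∷ L) ys (suc k) (s≤s k<) = nth-++ L ys k k<

catList-length : ∀ n → length (catList n) ≡ suc n
catList-length zero    = refl
catList-length (suc n) = Eq.trans (length-++ (catList n))
  (Eq.trans (cong (ℕ._+ 1) (catList-length n)) (ℕP.+-comm (suc n) 1))

nth-catList : ∀ n k → k ≤ n → nth k (catList n) ≡ Cq k
nth-catList zero    zero    _   = refl
nth-catList (suc n) k       k≤ with ℕP.m≤n⇒m<n∨m≡n k≤
... | inj₂ refl       = refl
... | inj₁ (s≤s k≤n) = Eq.trans
  (nth-++ (catList n) _ k (Eq.subst (k <_) (Eq.sym (catList-length n)) (s≤s k≤n)))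
  (nth-catList n k k≤n)

foldr-Σ : ∀ N (F : ℕ → Poly) (f : ℕ → ℕ) →
  foldr _+ₚ_ zeroₚ (map F (applyUpTo f N)) ≡ Σ N (λ k → F (f k))
foldr-Σ zero    F f = refl
foldr-Σ (suc N) F f = cong (F (f 0) +ₚ_) (foldr-Σ N F (λ k → f (suc k)))

Cq-suc : ∀ n → Cq (suc n) ≋ Σ (suc n) (λ k → pw k *ₚ Cq k *ₚ Cq (n ∸ k))
Cq-suc n = ≋-trans
  (≡⇒≋ (Eq.trans (nth-snoc (catList n) _ (suc n) (catList-length n)) (foldr-Σ (suc n) _ (λ k → k))))
  (Σ-cong< (suc n) (λ k k<1+n → *-cong (*-cong (qpow-pw k) (≡⇒≋ (nth-catList n k (ℕP.≤-pred k<1+n))))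
                                (≡⇒≋ (nth-catList n (n ∸ k) (ℕP.m∸n≤m n k)))))

open Catalan Cq ≋-refl Cq-suc using (T-even-length)

double≡*2 : ∀ m → double m ≡ m ℕ.* 2
double≡*2 zero    = refl
double≡*2 (suc m) = cong (λ k → suc (suc k)) (double≡*2 m)

Cstar-T₀ : ∀ m → Cstar m ≋ T₀ m 0
Cstar-T₀ m with m % 2 in m%2≡r
... | zero  = ≋-sym (≋-trans (≡⇒≋ (cong (λ k → T₀ k 0) m≡2h)) (T-even-length (m / 2)))
  where
  m≡2h : m ≡ double (m / 2)
  m≡2h = Eq.trans (m≡m%n+[m/n]*n m 2)
    (Eq.trans (cong (ℕ._+ (m / 2) ℕ.* 2) m%2≡r) (Eq.sym (double≡*2 (m / 2))))
... | suc r = ≋-sym (≋-trans (≡⇒≋ (cong (λ k → T₀ k 0) m≡2h+1)) (T-odd-length 0 (m / 2)))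
  where
  r≡0 : r ≡ 0
  r≡0 = ℕP.n≤0⇒n≡0 (ℕP.≤-pred (ℕP.≤-pred (Eq.subst (ℕ._< 2) m%2≡r (m%n<n m 2))))
  m≡2h+1 : m ≡ suc (double (m / 2))
  m≡2h+1 = Eq.trans (m≡m%n+[m/n]*n m 2)
    (Eq.trans (cong (ℕ._+ (m / 2) ℕ.* 2) (Eq.trans m%2≡r (cong suc r≡0)))
              (cong suc (Eq.sym (double≡*2 (m / 2)))))

binomial-triangle : ∀ k → k C 2 ≡ triangle k
binomial-triangle zero    = refl
binomial-triangle (suc k) = Eq.trans (Eq.sym (nCk+nC[k+1]≡[n+1]C[k+1] k 1))
  (Eq.cong₂ ℕ._+_ (nC1≡n k) (binomial-triangle k))

triangle-mono : ∀ {j i} → j ≤ i → triangle j ≤ triangle i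
triangle-mono z≤n       = z≤n
triangle-mono (s≤s j≤i) = ℕP.+-mono-≤ j≤i (triangle-mono j≤i)

diagBinom-value : ∀ n (i j : Fin (suc n)) → diagBinom n i j ≋ D (toℕ i) *ₚ δ (toℕ i) (toℕ j)
diagBinom-value n i j with i ≟ j
... | yes refl = ≋-sym (≋-trans (*-cong (≋-refl {D (toℕ i)}) (≡⇒≋ (δ-diagonal (toℕ i))))
  (≋-trans (*-identityʳ _) (≋-sym (≋-trans (qpow-pw _) (≡⇒≋ (cong pw (binomial-triangle (toℕ i))))))))
... | no i≢j  = ≋-sym (*-by-zero (D (toℕ i)) (≡⇒≋ (δ-off-diagonal (toℕ i) (toℕ j) (λ e → i≢j (toℕ-injective e)))))

diagBinom-diagonal : ∀ n → IsDiagonal (diagBinom n)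
diagBinom-diagonal n i j i≢j = un (≋-trans (diagBinom-value n i j)
  (*-by-zero (D (toℕ i)) (≡⇒≋ (δ-off-diagonal (toℕ i) (toℕ j) i≢j))))

diagBinom-entry : ∀ n (i j : Fin (suc n)) → toℕ i ≡ toℕ j → diagBinom n i j ≋ D (toℕ i)
diagBinom-entry n i j i≡j = ≋-trans (diagBinom-value n i j)
  (≋-trans (*-cong (≋-refl {D (toℕ i)}) (≡⇒≋ (Eq.trans (cong (δ (toℕ i)) (Eq.sym i≡j)) (δ-diagonal (toℕ i)))))
           (*-identityʳ _))

diagBinom-divisibility : ∀ n (i j i' j' : Fin (suc n)) → toℕ i ≡ toℕ i' → toℕ j ≡ toℕ j' →
  toℕ j ≤ toℕ i → diagBinom n j j' ∣ₚ diagBinom n i i'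
diagBinom-divisibility n i j i' j' i≡i' j≡j' j≤i = qpow (triangle (toℕ i) ∸ triangle (toℕ j)) , un (begin
  qpow (triangle (toℕ i) ∸ triangle (toℕ j)) *ₚ diagBinom n j j'
    ≈⟨ *-cong (qpow-pw (triangle (toℕ i) ∸ triangle (toℕ j))) (diagBinom-entry n j j' j≡j') ⟩
  pw (triangle (toℕ i) ∸ triangle (toℕ j)) *ₚ D (toℕ j)
    ≈⟨ ≋-sym (pw-+ (triangle (toℕ i) ∸ triangle (toℕ j)) (triangle (toℕ j))) ⟩
  pw (triangle (toℕ i) ∸ triangle (toℕ j) ℕ.+ triangle (toℕ j))
    ≈⟨ ≡⇒≋ (cong pw (ℕP.m∸n+n≡m (triangle-mono j≤i))) ⟩
  D (toℕ i)
    ≈⟨ ≋-sym (diagBinom-entry n i i' i≡i') ⟩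
  diagBinom n i i' ∎)

P-matrix Pᵀ-matrix : ∀ n → Matrix (suc n) (suc n)
P-matrix  n i j = P (toℕ i) (toℕ j)
Pᵀ-matrix n i j = P (toℕ j) (toℕ i)

det-P-matrix : ∀ n → det (P-matrix n) ≋ oneₚ
det-P-matrix n = det-lower-unitriangular (suc n) (P-matrix n)
  (λ i j i<j → P-vanish (toℕ i) (toℕ j) i<j) (λ i → P-diagonal (toℕ i))

det-Pᵀ-matrix : ∀ n → det (Pᵀ-matrix n) ≋ oneₚ
det-Pᵀ-matrix n = det-upper-unitriangular (suc n) (Pᵀ-matrix n)
  (λ i j j<i → P-vanish (toℕ j) (toℕ i) j<i) (λ i → P-diagonal (toℕ i))

hankel-diagonalised : ∀ n (i j : Fin (suc n)) →
  (P-matrix n · hankelCstar n · Pᵀ-matrix n) i j ≋ diagBinom n i j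
hankel-diagonalised n i j = begin
  (P-matrix n · hankelCstar n · Pᵀ-matrix n) i j
    ≈⟨ sumF-cong N (λ l → *-cong (≡⇒≋ (sumF-Σ N (λ k → P (toℕ i) k *ₚ Cstar (k ℕ.+ toℕ l))))
                                 (≋-refl {P (toℕ j) (toℕ l)})) ⟩
  sumF {N} (λ l → Σ N (λ k → P (toℕ i) k *ₚ Cstar (k ℕ.+ toℕ l)) *ₚ P (toℕ j) (toℕ l))
    ≈⟨ ≡⇒≋ (sumF-Σ N (λ l → Σ N (λ k → P (toℕ i) k *ₚ Cstar (k ℕ.+ l)) *ₚ P (toℕ j) l)) ⟩
  Σ N (λ l → Σ N (λ k → P (toℕ i) k *ₚ Cstar (k ℕ.+ l)) *ₚ P (toℕ j) l)
    ≈⟨ Σ-cong N (λ l → *-cong (Σ-cong N (λ k → *-cong (≋-refl {P (toℕ i) k}) (Cstar-T₀ (k ℕ.+ l))))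
                              (≋-refl {P (toℕ j) l})) ⟩
  Σ N (λ l → Σ N (λ k → P (toℕ i) k *ₚ T₀ (k ℕ.+ l) 0) *ₚ P (toℕ j) l)
    ≈⟨ P-hankel-Pᵀ N (toℕ i) (toℕ j) (toℕ<n i) (toℕ<n j) ⟩
  D (toℕ i) *ₚ δ (toℕ i) (toℕ j)
    ≈⟨ ≋-sym (diagBinom-value n i j) ⟩
  diagBinom n i j ∎
  where N = suc n

corollary4p1 : (n : ℕ) → IsSSNF (hankelCstar n) (diagBinom n)
corollary4p1 n =
    ( P-matrix n , Pᵀ-matrix n
    , un (det-P-matrix n) , un (det-Pᵀ-matrix n)
    , (λ i j → un (hankel-diagonalised n i j)) )
  , diagBinom-diagonal n
  , diagBinom-divisibility n
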